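{- Fix $t\in\mathbb{N}$ and let $\mathscr{C}$ be the class of $K_{t,t}$-free graphs. Then the distance-$1$ profile complexity satisfies $\nu_1(\mathscr{C},m)\le\mathcal{O}(m^t)$.
   Context: A graph is $K_{t,t}$-free if it has no $K_{t,t}$ subgraph. For a graph $G$, $S\subseteq V(G)$ and $v\in V(G)$, the distance-$1$ profile of $v$ on $S$ is the function $S\to\{0,1,\infty\}$ mapping $s$ to $\mathrm{dist}_G(v,s)$ if this is at most $1$ and to $\infty$ otherwise. $\nu_1(G,m)$ is the maximum over $S\subseteq V(G)$ with $|S|\le m$ of the number of distinct distance-$1$ profiles on $S$ realized by vertices of $G$, and $\nu_1(\mathscr{C},m)=\sup_{G\in\mathscr{C}}\nu_1(G,m)$. The constant in $\mathcal{O}$ may depend on $t$. -}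

module Defs where

open import Data.Nat using (ℕ; _≤_)
open import Data.Bool using (Bool; true; false)
open import Data.Fin using (Fin)
open import Data.Fin.Properties using () renaming (_≟_ to _≟ᶠ_)
open import Data.List using (List; map; length; deduplicate; allFin)
open import Data.List.Properties using (≡-dec)
open import Data.List.Relation.Unary.Unique.Propositional using (Unique)
open import Data.Product using (_×_)
open import Function.Definitions using (Injective)
open import Relation.Binary.PropositionalEquality using (_≡_; _≢_; refl)
open import Relation.Nullary using (Dec; yes; no)

record Graph (n : ℕ) : Set where
  field
    adj     : Fin n → Fin n → Bool
    symm    : ∀ u v → adj u v ≡ adj v u
    irrefl  : ∀ v → adj v v ≡ false
open Graph public

-- G contains K_{t,t} as a (not necessarily induced) subgraph:
-- two injective maps Fin t → V(G) with disjoint images, all cross pairs adjacent.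
HasKtt : ∀ {n} → ℕ → Graph n → Set
HasKtt {n} t G =
  Data.Product.Σ (Fin t → Fin n) λ a → Data.Product.Σ (Fin t → Fin n) λ b →
    Injective _≡_ _≡_ a × Injective _≡_ _≡_ b ×
    (∀ i j → a i ≢ b j) × (∀ i j → adj G (a i) (b j) ≡ true)

KttFree : ∀ {n} → ℕ → Graph n → Set
KttFree t G = HasKtt t G → Data.Empty.⊥
  where import Data.Empty

-- truncated distance values {0, 1, ∞}
data Dist : Set where
  d0 d1 d∞ : Dist

_≟D_ : (x y : Dist) → Dec (x ≡ y)
d0 ≟D d0 = yes refl
d0 ≟D d1 = no λ ()
d0 ≟D d∞ = no λ ()
d1 ≟D d0 = no λ ()
d1 ≟D d1 = yes refl
d1 ≟D d∞ = no λ ()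
d∞ ≟D d0 = no λ ()
d∞ ≟D d1 = no λ ()
d∞ ≟D d∞ = yes refl

dist1 : ∀ {n} → Graph n → Fin n → Fin n → Dist
dist1 G v s with v ≟ᶠ s
... | yes _ = d0
... | no _ with adj G v s
...   | true = d1
...   | false = d∞

profile : ∀ {n} → Graph n → List (Fin n) → Fin n → List Dist
profile G S v = map (dist1 G v) S

numProfiles : ∀ {n} → Graph n → List (Fin n) → ℕ
numProfiles G S = length (deduplicate (≡-dec _≟D_) (map (profile G S) (allFin _)))

ν₁≤ : ∀ {n} → Graph n → ℕ → ℕ → Set
ν₁≤ {n} G m N = (S : List (Fin n)) → Unique S → length S ≤ m → numProfiles G S ≤ N

module Submission where

-- Fix T = t ≥ 1 (for t = 0 every graph contains K_{0,0}) and
-- encode each profile word x ∈ {0,1,∞}^S by a code: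
--   * if x contains a 0 (the vertex lies in S), the position of that 0;
--   * otherwise the truncation of x that keeps only its first T ones.
-- A code of the first kind determines the vertex, hence the profile.  A
-- truncated word with fewer than T ones is the profile itself.  A truncated
-- word c with T ones is shared by fewer than T distinct profiles: T such
-- profiles come from T distinct vertices all adjacent to the T vertices of S
-- marked 1 in c, i.e. a K_{T,T}.  So every fibre of the code has at most T
-- profiles, while there are at most |S| + (|S|+1)^T codes; by pigeonhole the
-- number of profiles is at most T (|S| + (|S|+1)^T) ≤ T (1 + 2^T) m^T.

open import Defs
open import Data.Nat using (ℕ; zero; suc; _≤_; _<_; _*_; _^_; _+_; z≤n; s≤s; _<?_; _≤?_)
open import Data.Nat.Properties
open import Data.Bool using (Bool; true; false)
open import Data.Fin using (Fin; zero; suc; inject≤)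
open import Data.Fin.Properties using (inject≤-injective) renaming (_≟_ to _≟ᶠ_)
open import Data.List using (List; []; _∷_; map; length; _++_; filter; upTo; allFin; deduplicate; lookup)
open import Data.List.Properties using (length-map; length-++; length-upTo; ≡-dec)
open import Data.List.Membership.Propositional using (_∈_)
open import Data.List.Membership.Propositional.Properties using (∈-map⁺; ∈-++⁺ˡ; ∈-++⁺ʳ; ∈-upTo⁺; ∈-lookup)
open import Data.List.Relation.Unary.Any using (here; there)
open import Data.List.Relation.Unary.All as All using (All; []; _∷_)
open import Data.List.Relation.Unary.AllPairs using ([]; _∷_)
open import Data.List.Relation.Unary.Unique.Propositional using (Unique)
import Data.List.Relation.Unary.All.Properties as AllP
import Data.List.Relation.Unary.Unique.Propositional.Properties as UniqueP
import Data.List.Relation.Unary.Unique.DecPropositional.Properties as UniqueDecP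
open import Data.Product using (∃; _×_; _,_; proj₁; proj₂; Σ)
open import Data.Sum using (_⊎_; inj₁; inj₂)
import Data.Sum.Properties as SumP
open import Data.Empty using (⊥; ⊥-elim)
open import Function.Definitions using (Injective)
open import Relation.Binary using (DecidableEquality)
open import Relation.Binary.PropositionalEquality
open import Relation.Nullary using (yes; no; ¬_; ¬?)
open import Relation.Unary using (Decidable)

lookup-injective : ∀ {A : Set} {xs : List A} → Unique xs → Injective _≡_ _≡_ (lookup xs)
lookup-injective {xs = x ∷ xs} u        {zero}  {zero}  e = refl
lookup-injective {xs = x ∷ xs} (x∉ ∷ u) {zero}  {suc j} e = ⊥-elim (All.lookup x∉ (∈-lookup j) e)
lookup-injective {xs = x ∷ xs} (x∉ ∷ u) {suc i} {zero}  e = ⊥-elim (All.lookup x∉ (∈-lookup i) (sym e))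
lookup-injective {xs = x ∷ xs} (x∉ ∷ u) {suc i} {suc j} e = cong suc (lookup-injective u e)

distinctMembers : ∀ {A : Set} t (xs : List A) → Unique xs → t ≤ length xs →
  Σ (Fin t → A) λ g → Injective _≡_ _≡_ g × (∀ i → g i ∈ xs)
distinctMembers t xs u t≤ =
    (λ i → lookup xs (inject≤ i t≤))
  , (λ {i} {j} e → inject≤-injective t≤ t≤ i j (lookup-injective u e))
  , (λ i → ∈-lookup (inject≤ i t≤))

atMostOne : ∀ {A : Set} {P : A → Set} (xs : List A) → Unique xs → All P xs →
  (∀ {x y} → P x → P y → x ≡ y) → length xs ≤ 1
atMostOne []          u                 ps              P-unique = z≤n
atMostOne (x ∷ [])    u                 ps              P-unique = s≤s z≤n
atMostOne (x ∷ y ∷ _) ((x≢y ∷ _) ∷ _) (px ∷ py ∷ _) P-unique = ⊥-elim (x≢y (P-unique px py))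

length-filter-split : ∀ {A : Set} {Q : A → Set} (Q? : Decidable Q) xs →
  length xs ≡ length (filter Q? xs) + length (filter (λ x → ¬? (Q? x)) xs)
length-filter-split Q? [] = refl
length-filter-split Q? (x ∷ xs) with Q? x
... | yes _ = cong suc (length-filter-split Q? xs)
... | no _  = trans (cong suc (length-filter-split Q? xs)) (sym (+-suc _ _))

pigeonhole : ∀ {A C : Set} (_≟_ : DecidableEquality C) (code : A → C) (k : ℕ) (R : A → Set) →
  (∀ d (xs : List A) → Unique xs → All (λ x → R x × code x ≡ d) xs → length xs ≤ k) →
  ∀ D xs → Unique xs → All R xs → All (λ x → code x ∈ D) xs → length xs ≤ k * length D
pigeonhole _≟_ code k R fibre [] []      u rs cs       = z≤n
pigeonhole _≟_ code k R fibre [] (x ∷ _) u rs (() ∷ _)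
pigeonhole _≟_ code k R fibre (d ∷ D) xs u rs cs = begin
    length xs
  ≡⟨ length-filter-split hit? xs ⟩
    length (filter hit? xs) + length (filter miss? xs)
  ≤⟨ +-mono-≤ hits misses ⟩
    k + k * length D
  ≡⟨ sym (*-suc k (length D)) ⟩
    k * length (d ∷ D)
  ∎
  where
  open ≤-Reasoning
  hit? : Decidable (λ x → code x ≡ d)
  hit? x = code x ≟ d
  miss? : Decidable (λ x → ¬ code x ≡ d)
  miss? x = ¬? (hit? x)
  hits : length (filter hit? xs) ≤ k
  hits = fibre d (filter hit? xs) (UniqueP.filter⁺ hit? u)
           (All.zip (AllP.filter⁺ hit? rs , AllP.all-filter hit? xs))
  inRest : ∀ {x} → code x ∈ d ∷ D → ¬ code x ≡ d → code x ∈ D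
  inRest (here e)  ne = ⊥-elim (ne e)
  inRest (there i) ne = i
  misses : length (filter miss? xs) ≤ k * length D
  misses = pigeonhole _≟_ code k R fibre D (filter miss? xs) (UniqueP.filter⁺ miss? u)
             (AllP.filter⁺ miss? rs)
             (All.zipWith (λ (i , ne) → inRest i ne) (AllP.filter⁺ miss? cs , AllP.all-filter miss? xs))

ones : List Dist → ℕ
ones []       = 0
ones (d0 ∷ w) = ones w
ones (d1 ∷ w) = suc (ones w)
ones (d∞ ∷ w) = ones w

hasZero : List Dist → Bool
hasZero []       = false
hasZero (d0 ∷ w) = true
hasZero (d1 ∷ w) = hasZero w
hasZero (d∞ ∷ w) = hasZero w

zeroPos : List Dist → ℕ
zeroPos []       = 0
zeroPos (d0 ∷ w) = 0
zeroPos (d1 ∷ w) = suc (zeroPos w)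
zeroPos (d∞ ∷ w) = suc (zeroPos w)

truncate : ℕ → List Dist → List Dist
truncate k       []       = []
truncate k       (d0 ∷ w) = d0 ∷ truncate k w
truncate zero    (d1 ∷ w) = d∞ ∷ truncate zero w
truncate (suc k) (d1 ∷ w) = d1 ∷ truncate k w
truncate k       (d∞ ∷ w) = d∞ ∷ truncate k w

sparseWords : ℕ → ℕ → List (List Dist)
sparseWords zero    k       = [] ∷ []
sparseWords (suc L) zero    = map (d∞ ∷_) (sparseWords L zero)
sparseWords (suc L) (suc k) = map (d∞ ∷_) (sparseWords L (suc k)) ++ map (d1 ∷_) (sparseWords L k)

truncate-id : ∀ k w → ones (truncate k w) < k → truncate k w ≡ w
truncate-id k       []       few = refl
truncate-id k       (d0 ∷ w) few = cong (d0 ∷_) (truncate-id k w few)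
truncate-id (suc k) (d1 ∷ w) (s≤s few) = cong (d1 ∷_) (truncate-id k w few)
truncate-id zero    (d∞ ∷ w) few = cong (d∞ ∷_) (truncate-id zero w few)
truncate-id (suc k) (d∞ ∷ w) few = cong (d∞ ∷_) (truncate-id (suc k) w few)

truncate∈sparseWords : ∀ k w → hasZero w ≡ false → truncate k w ∈ sparseWords (length w) k
truncate∈sparseWords k       []       _ = here refl
truncate∈sparseWords zero    (d1 ∷ w) z = ∈-map⁺ (d∞ ∷_) (truncate∈sparseWords zero w z)
truncate∈sparseWords (suc k) (d1 ∷ w) z =
  ∈-++⁺ʳ (map (d∞ ∷_) (sparseWords (length w) (suc k))) (∈-map⁺ (d1 ∷_) (truncate∈sparseWords k w z))
truncate∈sparseWords zero    (d∞ ∷ w) z = ∈-map⁺ (d∞ ∷_) (truncate∈sparseWords zero w z)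
truncate∈sparseWords (suc k) (d∞ ∷ w) z = ∈-++⁺ˡ (∈-map⁺ (d∞ ∷_) (truncate∈sparseWords (suc k) w z))

-- There are at most (L+1)^k sparse words: choose at most k positions out of L.
length-sparseWords : ∀ L k → length (sparseWords L k) ≤ suc L ^ k
length-sparseWords zero    k       = ≤-reflexive (sym (^-zeroˡ k))
length-sparseWords (suc L) zero    =
  ≤-trans (≤-reflexive (length-map (d∞ ∷_) (sparseWords L zero))) (length-sparseWords L zero)
length-sparseWords (suc L) (suc k) = begin
    length (map (d∞ ∷_) (sparseWords L (suc k)) ++ map (d1 ∷_) (sparseWords L k))
  ≡⟨ length-++ (map (d∞ ∷_) (sparseWords L (suc k))) ⟩
    length (map (d∞ ∷_) (sparseWords L (suc k))) + length (map (d1 ∷_) (sparseWords L k))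
  ≡⟨ cong₂ _+_ (length-map (d∞ ∷_) (sparseWords L (suc k))) (length-map (d1 ∷_) (sparseWords L k)) ⟩
    length (sparseWords L (suc k)) + length (sparseWords L k)
  ≤⟨ +-mono-≤ (length-sparseWords L (suc k)) (length-sparseWords L k) ⟩
    suc L * suc L ^ k + suc L ^ k
  ≡⟨ +-comm (suc L * suc L ^ k) (suc L ^ k) ⟩
    suc (suc L) * suc L ^ k
  ≤⟨ *-monoʳ-≤ (suc (suc L)) (^-monoˡ-≤ k (n≤1+n (suc L))) ⟩
    suc (suc L) ^ suc k
  ∎
  where open ≤-Reasoning

zeroPos<length : ∀ w → hasZero w ≡ true → zeroPos w < length w
zeroPos<length (d0 ∷ w) z = s≤s z≤n
zeroPos<length (d1 ∷ w) z = s≤s (zeroPos<length w z)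
zeroPos<length (d∞ ∷ w) z = s≤s (zeroPos<length w z)

sameZeroPos : ∀ {A : Set} (f g : A → Dist) S → hasZero (map f S) ≡ true →
  zeroPos (map f S) ≡ zeroPos (map g S) → ∃ λ s → f s ≡ d0 × g s ≡ d0
sameZeroPos f g (s ∷ S) z e with f s in fs | g s in gs
... | d0 | d0 = s , fs , gs
... | d0 | d1 = ⊥-elim (0≢1+n e)
... | d0 | d∞ = ⊥-elim (0≢1+n e)
... | d1 | d0 = ⊥-elim (0≢1+n (sym e))
... | d∞ | d0 = ⊥-elim (0≢1+n (sym e))
... | d1 | d1 = sameZeroPos f g S z (suc-injective e)
... | d1 | d∞ = sameZeroPos f g S z (suc-injective e)
... | d∞ | d1 = sameZeroPos f g S z (suc-injective e)
... | d∞ | d∞ = sameZeroPos f g S z (suc-injective e)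

onesIn : ∀ {A : Set} → List Dist → List A → List A
onesIn w        []      = []
onesIn []       (s ∷ S) = []
onesIn (d0 ∷ w) (s ∷ S) = onesIn w S
onesIn (d1 ∷ w) (s ∷ S) = s ∷ onesIn w S
onesIn (d∞ ∷ w) (s ∷ S) = onesIn w S

onesIn-all : ∀ {A : Set} {P : A → Set} w S → All P S → All P (onesIn w S)
onesIn-all w        []      ps       = []
onesIn-all []       (s ∷ S) ps       = []
onesIn-all (d0 ∷ w) (s ∷ S) (p ∷ ps) = onesIn-all w S ps
onesIn-all (d1 ∷ w) (s ∷ S) (p ∷ ps) = p ∷ onesIn-all w S ps
onesIn-all (d∞ ∷ w) (s ∷ S) (p ∷ ps) = onesIn-all w S ps

onesIn-unique : ∀ {A : Set} w (S : List A) → Unique S → Unique (onesIn w S)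
onesIn-unique w        []      u        = []
onesIn-unique []       (s ∷ S) u        = []
onesIn-unique (d0 ∷ w) (s ∷ S) (p ∷ u) = onesIn-unique w S u
onesIn-unique (d1 ∷ w) (s ∷ S) (p ∷ u) = onesIn-all w S p ∷ onesIn-unique w S u
onesIn-unique (d∞ ∷ w) (s ∷ S) (p ∷ u) = onesIn-unique w S u

length-onesIn-truncate : ∀ {A : Set} k (f : A → Dist) S →
  length (onesIn (truncate k (map f S)) S) ≡ ones (truncate k (map f S))
length-onesIn-truncate k f [] = refl
length-onesIn-truncate k f (s ∷ S) with f s
... | d0 = length-onesIn-truncate k f S
length-onesIn-truncate zero    f (s ∷ S) | d1 = length-onesIn-truncate zero f S
length-onesIn-truncate (suc k) f (s ∷ S) | d1 = cong suc (length-onesIn-truncate k f S)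
... | d∞ = length-onesIn-truncate k f S

onesIn-truncate-one : ∀ {A : Set} k (f : A → Dist) S s →
  s ∈ onesIn (truncate k (map f S)) S → f s ≡ d1
onesIn-truncate-one k f (s′ ∷ S) s s∈ with f s′ in fs′
... | d0 = onesIn-truncate-one k f S s s∈
onesIn-truncate-one zero    f (s′ ∷ S) s s∈         | d1 = onesIn-truncate-one zero f S s s∈
onesIn-truncate-one (suc k) f (s′ ∷ S) s (here refl) | d1 = fs′
onesIn-truncate-one (suc k) f (s′ ∷ S) s (there s∈) | d1 = onesIn-truncate-one k f S s s∈
... | d∞ = onesIn-truncate-one k f S s s∈

dist1-zero : ∀ {n} (G : Graph n) v s → dist1 G v s ≡ d0 → v ≡ s
dist1-zero G v s e with v ≟ᶠ s
... | yes v≡s = v≡s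
... | no _ with adj G v s
dist1-zero G v s () | no _ | true
dist1-zero G v s () | no _ | false

dist1-one : ∀ {n} (G : Graph n) v s → dist1 G v s ≡ d1 → adj G v s ≡ true
dist1-one G v s e with v ≟ᶠ s
dist1-one G v s () | yes _
... | no _ with adj G v s
... | true = refl
dist1-one G v s () | no _ | false

-- Two injective t-tuples of vertices with every cross pair adjacent form a
-- K_{t,t}; the two sides are automatically disjoint since G has no loops.
biclique : ∀ {n t} (G : Graph n) (a b : Fin t → Fin n) → Injective _≡_ _≡_ a → Injective _≡_ _≡_ b →
  (∀ i j → adj G (a i) (b j) ≡ true) → HasKtt t G
biclique G a b a-inj b-inj a~b = a , b , a-inj , b-inj , disjoint , a~b
  where
  disjoint : ∀ i j → a i ≢ b j
  disjoint i j ai≡bj with trans (sym (subst (λ v → adj G v (b j) ≡ true) ai≡bj (a~b i j))) (irrefl G (b j))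
  ... | ()

-- Every graph contains K_{0,0}, so the case t = 0 of the theorem is vacuous.
hasK00 : ∀ {n} (G : Graph n) → HasKtt 0 G
hasK00 G = biclique G (λ ()) (λ ()) (λ {i} → ⊥-elim (noFin0 i)) (λ {i} → ⊥-elim (noFin0 i)) (λ ())
  where
  noFin0 : Fin 0 → ⊥
  noFin0 ()

code : ℕ → List Dist → ℕ ⊎ List Dist
code T w with hasZero w
... | true  = inj₁ (zeroPos w)
... | false = inj₂ (truncate T w)

code-inj₁ : ∀ T w i → code T w ≡ inj₁ i → hasZero w ≡ true × zeroPos w ≡ i
code-inj₁ T w i e with hasZero w
code-inj₁ T w i refl | true = refl , refl

code-inj₂ : ∀ T w c → code T w ≡ inj₂ c → truncate T w ≡ c
code-inj₂ T w c e with hasZero w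
code-inj₂ T w c refl | false = refl

module ProfileCount {n : ℕ} (G : Graph n) (S : List (Fin n)) (uS : Unique S) (t : ℕ)
                    (free : KttFree (suc t) G) where
  T : ℕ
  T = suc t

  Realised : List Dist → Set
  Realised w = ∃ λ v → profile G S v ≡ w

  adjacentToOnes : ∀ v c s → truncate T (profile G S v) ≡ c → s ∈ onesIn c S → adj G v s ≡ true
  adjacentToOnes v c s trunc s∈ =
    dist1-one G v s (onesIn-truncate-one T (dist1 G v) S s (subst (λ c′ → s ∈ onesIn c′ S) (sym trunc) s∈))

  -- T distinct vertices whose profiles all truncate to a word c with at
  -- least T ones form one side of a K_{T,T}; the other side is picked among
  -- the vertices of S marked 1 in c.
  commonNeighbours : ∀ c (a : Fin T → Fin n) → Injective _≡_ _≡_ a →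
    (∀ i → truncate T (profile G S (a i)) ≡ c) → T ≤ ones c → HasKtt T G
  commonNeighbours c a a-inj a-trunc T≤ones with distinctMembers T (onesIn c S) (onesIn-unique c S uS) T≤|ones|
    where
    length-ones : length (onesIn c S) ≡ ones c
    length-ones = subst (λ c′ → length (onesIn c′ S) ≡ ones c′) (a-trunc zero)
                        (length-onesIn-truncate T (dist1 G (a zero)) S)
    T≤|ones| : T ≤ length (onesIn c S)
    T≤|ones| = ≤-trans T≤ones (≤-reflexive (sym length-ones))
  ... | b , b-inj , b∈ = biclique G a b a-inj b-inj (λ i j → adjacentToOnes (a i) c (b j) (a-trunc i) (b∈ j))

  largeFibre : ∀ c (ws : List (List Dist)) → Unique ws → All (λ w → Realised w × truncate T w ≡ c) ws →
    T ≤ ones c → T ≤ length ws → HasKtt T G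
  largeFibre c ws uws fibre T≤ones T≤ws with distinctMembers T ws uws T≤ws
  ... | member , member-inj , member∈ = commonNeighbours c a a-inj a-trunc T≤ones
    where
    witness : ∀ i → Realised (member i) × truncate T (member i) ≡ c
    witness i = All.lookup fibre (member∈ i)
    a : Fin T → Fin n
    a i = proj₁ (proj₁ (witness i))
    a-profile : ∀ i → profile G S (a i) ≡ member i
    a-profile i = proj₂ (proj₁ (witness i))
    a-trunc : ∀ i → truncate T (profile G S (a i)) ≡ c
    a-trunc i = trans (cong (truncate T) (a-profile i)) (proj₂ (witness i))
    a-inj : Injective _≡_ _≡_ a
    a-inj {i} {j} ai≡aj = member-inj (trans (sym (a-profile i)) (trans (cong (profile G S) ai≡aj) (a-profile j)))

  fibreBound : ∀ d (ws : List (List Dist)) → Unique ws → All (λ w → Realised w × code T w ≡ d) ws → length ws ≤ T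
  fibreBound (inj₁ i) ws uws fibre = ≤-trans (atMostOne ws uws fibre sameVertex) (s≤s z≤n)
    where
    -- a 0 at position i pins the vertex down to the i-th element of S
    sameVertex : ∀ {w w′} → Realised w × code T w ≡ inj₁ i → Realised w′ × code T w′ ≡ inj₁ i → w ≡ w′
    sameVertex ((v , refl) , e) ((v′ , refl) , e′)
      with code-inj₁ T _ i e | code-inj₁ T _ i e′
    ... | hasZ , pos | _ , pos′
      with sameZeroPos (dist1 G v) (dist1 G v′) S hasZ (trans pos (sym pos′))
    ... | s , vs , v′s = cong (profile G S) (trans (dist1-zero G v s vs) (sym (dist1-zero G v′ s v′s)))
  fibreBound (inj₂ c) ws uws fibre with ones c <? T | T ≤? length ws
  ... | yes few | _       = ≤-trans (atMostOne ws uws fibre equalsCode) (s≤s z≤n)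
    where
    -- with fewer than T ones the truncation is the profile itself
    isCode : ∀ {w} → code T w ≡ inj₂ c → w ≡ c
    isCode {w} e = trans (sym (truncate-id T w (subst (λ c′ → ones c′ < T) (sym trunc) few))) trunc
      where trunc = code-inj₂ T w c e
    equalsCode : ∀ {w w′} → Realised w × code T w ≡ inj₂ c → Realised w′ × code T w′ ≡ inj₂ c → w ≡ w′
    equalsCode (_ , e) (_ , e′) = trans (isCode e) (sym (isCode e′))
  ... | no many | yes big = ⊥-elim (free (largeFibre c ws uws
                              (All.map (λ {w} (r , e) → r , code-inj₂ T w c e) fibre) (≮⇒≥ many) big))
  ... | no _    | no small = <⇒≤ (≰⇒> small)

  codebook : List (ℕ ⊎ List Dist)
  codebook = map inj₁ (upTo (length S)) ++ map inj₂ (sparseWords (length S) T)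

  code∈codebook : ∀ v → code T (profile G S v) ∈ codebook
  code∈codebook v with hasZero (profile G S v) in z
  ... | true  = ∈-++⁺ˡ (∈-map⁺ inj₁ (∈-upTo⁺ (subst (zeroPos (profile G S v) <_)
                  (length-map (dist1 G v) S) (zeroPos<length _ z))))
  ... | false = ∈-++⁺ʳ (map inj₁ (upTo (length S))) (∈-map⁺ inj₂ (subst (λ L → truncate T (profile G S v) ∈ sparseWords L T)
                  (length-map (dist1 G v) S) (truncate∈sparseWords T _ z)))

  length-codebook : length codebook ≤ length S + suc (length S) ^ T
  length-codebook = begin
      length codebook
    ≡⟨ length-++ (map inj₁ (upTo (length S))) ⟩
      length (map inj₁ (upTo (length S))) + length (map inj₂ (sparseWords (length S) T))
    ≡⟨ cong₂ _+_ (trans (length-map inj₁ (upTo (length S))) (length-upTo (length S)))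
                 (length-map inj₂ (sparseWords (length S) T)) ⟩
      length S + length (sparseWords (length S) T)
    ≤⟨ +-monoʳ-≤ (length S) (length-sparseWords (length S) T) ⟩
      length S + suc (length S) ^ T
    ∎
    where open ≤-Reasoning

  profileBound : numProfiles G S ≤ T * (length S + suc (length S) ^ T)
  profileBound = ≤-trans
    (pigeonhole (SumP.≡-dec _≟_ (≡-dec _≟D_)) (code T) T Realised fibreBound codebook profiles
       (UniqueDecP.deduplicate-! (≡-dec _≟D_) (map (profile G S) (allFin n))) realised
       (All.map (λ { (v , refl) → code∈codebook v }) realised))
    (*-monoʳ-≤ T length-codebook)
    where
    profiles : List (List Dist)
    profiles = deduplicate (≡-dec _≟D_) (map (profile G S) (allFin n))
    realised : All Realised profiles
    realised = AllP.deduplicate⁺ (≡-dec _≟D_) (AllP.map⁺ (AllP.tabulate⁺ (λ v → v , refl)))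

*-^-distrib : ∀ x y k → (x * y) ^ k ≡ x ^ k * y ^ k
*-^-distrib x y zero    = refl
*-^-distrib x y (suc k) = begin
    (x * y) * (x * y) ^ k
  ≡⟨ cong ((x * y) *_) (*-^-distrib x y k) ⟩
    (x * y) * (x ^ k * y ^ k)
  ≡⟨ [m*n]*[o*p]≡[m*o]*[n*p] x y (x ^ k) (y ^ k) ⟩
    (x * x ^ k) * (y * y ^ k)
  ∎
  where open ≡-Reasoning

codebookEstimate : ∀ t m L → L ≤ suc m → L + suc L ^ suc t ≤ (1 + 2 ^ suc t) * suc m ^ suc t
codebookEstimate t m L L≤ = +-mono-≤ L≤m^T (begin
    suc L ^ suc t
  ≤⟨ ^-monoˡ-≤ (suc t) 1+L≤2m ⟩
    (2 * suc m) ^ suc t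
  ≡⟨ *-^-distrib 2 (suc m) (suc t) ⟩
    2 ^ suc t * suc m ^ suc t
  ∎)
  where
  open ≤-Reasoning
  L≤m^T : L ≤ suc m ^ suc t
  L≤m^T = ≤-trans L≤ (m≤m*n (suc m) (suc m ^ t) {{m^n≢0 (suc m) t}})
  1+L≤2m : suc L ≤ 2 * suc m
  1+L≤2m = begin
      suc L
    ≤⟨ s≤s L≤ ⟩
      1 + suc m
    ≤⟨ +-monoˡ-≤ (suc m) (s≤s z≤n) ⟩
      suc m + suc m
    ≡⟨ cong (suc m +_) (sym (+-identityʳ (suc m))) ⟩
      2 * suc m
    ∎

lemma48 : (t : ℕ) → ∃ λ C → ∃ λ m₀ →
            ∀ (m : ℕ) → m₀ ≤ m → ∀ (n : ℕ) (G : Graph n) → KttFree t G →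
              ν₁≤ G m (C * m ^ t)
lemma48 zero    = 0 , 0 , λ m _ n G free → ⊥-elim (free (hasK00 G))
lemma48 (suc t) = suc t * (1 + 2 ^ suc t) , 1 , bound
  where
  bound : ∀ (m : ℕ) → 1 ≤ m → ∀ (n : ℕ) (G : Graph n) → KttFree (suc t) G →
          ν₁≤ G m ((suc t * (1 + 2 ^ suc t)) * m ^ suc t)
  bound (suc m) _ n G free S uS |S|≤m = begin
      numProfiles G S
    ≤⟨ ProfileCount.profileBound G S uS t free ⟩
      suc t * (length S + suc (length S) ^ suc t)
    ≤⟨ *-monoʳ-≤ (suc t) (codebookEstimate t m (length S) |S|≤m) ⟩
      suc t * ((1 + 2 ^ suc t) * suc m ^ suc t)
    ≡⟨ sym (*-assoc (suc t) (1 + 2 ^ suc t) (suc m ^ suc t)) ⟩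
      (suc t * (1 + 2 ^ suc t)) * suc m ^ suc t
    ∎
    where open ≤-Reasoning
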